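{- Let $n>1$ and $m\geqslant 2n-1$ be integers. (i) If $m$ is a prime or a power of two, then $k(k-1)\not\equiv l(l-1)\pmod m$ for all $1\leqslant k<l\leqslant n$. (ii) If $m$ is a power of two with $m\leqslant 2.4n$, then $2k(k-1)\equiv 2l(l-1)\pmod m$ for some $1\leqslant k<l\leqslant n$. -}

module Defs where

open import Data.Nat using (ℕ; _^_; NonZero)
open import Data.Nat.DivMod using (_%_)
open import Data.Product using (∃)
open import Relation.Binary.PropositionalEquality using (_≡_)

infix 4 _≡ₘ_[mod_]
_≡ₘ_[mod_] : ℕ → ℕ → (m : ℕ) → .{{NonZero m}} → Set
a ≡ₘ b [mod m ] = a % m ≡ b % m

IsPowerOfTwo : ℕ → Set
IsPowerOfTwo m = ∃ λ j → m ≡ 2 ^ j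

module Submission where

-- Write P(a) = (a + 1)·a, so that k(k - 1) = P(k - 1).  Everything rests on
--     P(b) = P(a) + (b - a)·(a + b + 1)            for a ≤ b,
-- whose two factors d = b - a and s = a + b + 1 have the odd sum 2b + 1.
-- (i)  For 0 ≤ a < b ≤ n - 1 and m ≥ 2n - 1 both factors satisfy 0 < d, s < m,
--      so P(a) ≡ P(b) (mod m) would mean m ∣ d·s.  A prime m cannot divide a
--      product of two such small positive numbers (Euclid's lemma), and neither
--      can m = 2^j: one of d, s is odd, so 2^j would divide the other one.
-- (ii) Doubling gives 2P(b) = 2P(a) + d·2s, so 2P(a) ≡ 2P(b) modulo 2s.  For
--      m = 2h a power of two take b = n - 1 and a = h - n, so that 2s = m; the
--      bounds 2n - 1 ≤ m ≤ 2.4n are exactly what makes 0 ≤ a < b.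

open import Defs
open import Data.Nat using (ℕ; _+_; _*_; _∸_; _≤_; _<_; NonZero; zero; suc; z≤n; s≤s; s≤s⁻¹; _^_)
open import Data.Nat.Primality using (Prime; euclidsLemma; prime[2]; prime⇒nonZero)
open import Data.Nat.Properties
open import Data.Nat.DivMod using (_%_; _/_; m≡m%n+[m/n]*n; [m+kn]%n≡m%n; %-congˡ)
open import Data.Nat.Divisibility
  using (_∣_; divides; _∣?_; ∣m+n∣m⇒∣n; ∣m∣n⇒∣m+n; n∣m*n; *-cancelˡ-∣; *-monoʳ-∣; ∣-trans; >⇒∤; 1∣_)
open import Data.Nat.Tactic.RingSolver using (solve-∀)
open import Data.Product using (_×_; ∃; _,_)
open import Data.Sum using (_⊎_; inj₁; inj₂)
open import Data.Empty using (⊥-elim)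
open import Relation.Nullary using (¬_; yes; no)
open import Relation.Binary.PropositionalEquality
  using (_≡_; refl; sym; trans; cong; subst; module ≡-Reasoning)

pronic-gap-+ : ∀ a d → suc (a + d) * (a + d) ≡ suc a * a + d * suc (a + (a + d))
pronic-gap-+ = solve-∀

pronic-gap : ∀ {a b} → a ≤ b → suc b * b ≡ suc a * a + (b ∸ a) * suc (a + b)
pronic-gap {a} {b} a≤b = begin
  suc b * b                           ≡⟨ cong (λ t → suc t * t) (sym a+d≡b) ⟩
  suc (a + d) * (a + d)               ≡⟨ pronic-gap-+ a d ⟩
  suc a * a + d * suc (a + (a + d))   ≡⟨ cong (λ t → suc a * a + d * suc (a + t)) a+d≡b ⟩
  suc a * a + d * suc (a + b)         ∎
  where
  open ≡-Reasoning
  d = b ∸ a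
  a+d≡b : a + d ≡ b
  a+d≡b = m+[n∸m]≡n a≤b

doubled-pronic-gap : ∀ {a b} → a ≤ b →
  2 * (suc b * b) ≡ 2 * (suc a * a) + (b ∸ a) * (2 * suc (a + b))
doubled-pronic-gap {a} {b} a≤b = begin
  2 * (suc b * b)                         ≡⟨ cong (2 *_) (pronic-gap a≤b) ⟩
  2 * (suc a * a + d * s)                 ≡⟨ *-distribˡ-+ 2 (suc a * a) (d * s) ⟩
  2 * (suc a * a) + 2 * (d * s)           ≡⟨ cong (2 * (suc a * a) +_) (sym (*-assoc 2 d s)) ⟩
  2 * (suc a * a) + 2 * d * s             ≡⟨ cong (λ t → 2 * (suc a * a) + t * s) (*-comm 2 d) ⟩
  2 * (suc a * a) + d * 2 * s             ≡⟨ cong (2 * (suc a * a) +_) (*-assoc d 2 s) ⟩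
  2 * (suc a * a) + d * (2 * s)           ∎
  where
  open ≡-Reasoning
  d = b ∸ a
  s = suc (a + b)

gap-plus-sum : ∀ {a b} → a ≤ b → (b ∸ a) + suc (a + b) ≡ suc (b + b)
gap-plus-sum {a} {b} a≤b = begin
  (b ∸ a) + suc (a + b)     ≡⟨ +-suc (b ∸ a) (a + b) ⟩
  suc ((b ∸ a) + (a + b))   ≡⟨ cong suc (sym (+-assoc (b ∸ a) a b)) ⟩
  suc ((b ∸ a) + a + b)     ≡⟨ cong (λ t → suc (t + b)) (m∸n+n≡m a≤b) ⟩
  suc (b + b)               ∎
  where open ≡-Reasoning

odd-not-even : ∀ b → ¬ 2 ∣ suc (b + b)
odd-not-even b (divides q eq) =
  even≢odd q b (trans (*-comm 2 q) (trans (sym eq) (cong (λ t → suc (b + t)) (sym (+-identityʳ b)))))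

≡ₘ-shift⇒∣ : ∀ a x m .{{_ : NonZero m}} → a ≡ₘ a + x [mod m ] → m ∣ x
≡ₘ-shift⇒∣ a x m eq = ∣m+n∣m⇒∣n (divides ((a + x) / m) qm+x≡q'm) (n∣m*n (a / m))
  where
  open ≡-Reasoning
  qm+x≡q'm : a / m * m + x ≡ (a + x) / m * m
  qm+x≡q'm = +-cancelˡ-≡ (a % m) _ _ (begin
    a % m + (a / m * m + x)     ≡⟨ sym (+-assoc (a % m) (a / m * m) x) ⟩
    a % m + a / m * m + x       ≡⟨ cong (_+ x) (sym (m≡m%n+[m/n]*n a m)) ⟩
    a + x                       ≡⟨ m≡m%n+[m/n]*n (a + x) m ⟩
    (a + x) % m + (a + x) / m * m ≡⟨ cong (_+ (a + x) / m * m) (sym eq) ⟩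
    a % m + (a + x) / m * m     ∎)

prime-power-∣-cofactor : ∀ {p} j x y → Prime p → ¬ p ∣ y → p ^ j ∣ x * y → p ^ j ∣ x
prime-power-∣-cofactor zero x y _ _ _ = 1∣ x
prime-power-∣-cofactor {p} (suc j) x y pp p∤y pʲ⁺¹∣xy
  with euclidsLemma x y pp (∣-trans (n∣m*n (p ^ j)) (subst (_∣ x * y) (*-comm p (p ^ j)) pʲ⁺¹∣xy))
... | inj₂ p∣y = ⊥-elim (p∤y p∣y)
... | inj₁ (divides q refl) = subst (p ^ suc j ∣_) (*-comm p q) (*-monoʳ-∣ p pʲ∣q)
  where
  instance _ = prime⇒nonZero pp
  pʲ∣q : p ^ j ∣ q
  pʲ∣q = prime-power-∣-cofactor j q y pp p∤y
    (*-cancelˡ-∣ p (subst (p * p ^ j ∣_) (trans (cong (_* y) (*-comm q p)) (*-assoc p q y)) pʲ⁺¹∣xy))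

small-nonmultiple : ∀ {x m} → 0 < x → x < m → ¬ m ∣ x
small-nonmultiple {suc _} _ x<m = >⇒∤ x<m

small-product-nonmultiple : ∀ {m x y} → Prime m ⊎ IsPowerOfTwo m →
  0 < x → x < m → 0 < y → y < m → ¬ 2 ∣ x + y → ¬ m ∣ x * y
small-product-nonmultiple {x = x} {y} (inj₁ pm) 0<x x<m 0<y y<m _ m∣xy
  with euclidsLemma x y pm m∣xy
... | inj₁ m∣x = small-nonmultiple 0<x x<m m∣x
... | inj₂ m∣y = small-nonmultiple 0<y y<m m∣y
small-product-nonmultiple {x = x} {y} (inj₂ (j , refl)) 0<x x<m 0<y y<m odd m∣xy
  with 2 ∣? x
... | no 2∤x = small-nonmultiple 0<y y<m
        (prime-power-∣-cofactor j y x prime[2] 2∤x (subst (2 ^ j ∣_) (*-comm x y) m∣xy))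
... | yes 2∣x = small-nonmultiple 0<x x<m
        (prime-power-∣-cofactor j x y prime[2] (λ 2∣y → odd (∣m∣n⇒∣m+n 2∣x 2∣y)) m∣xy)

double-below : ∀ {b n m} → b < n → 2 * n ∸ 1 ≤ m → 2 * b < m
double-below {b} {n} {m} b<n 2n∸1≤m = begin-strict
  2 * b          ≡⟨ cong (b +_) (+-identityʳ b) ⟩
  b + b          <⟨ n<1+n (b + b) ⟩
  suc (b + b)    ≡⟨ sym (+-suc b b) ⟩
  b + suc b      ≡⟨ cong (λ t → b + suc t) (sym (+-identityʳ b)) ⟩
  2 * suc b ∸ 1  ≤⟨ ∸-monoˡ-≤ 1 (*-monoʳ-≤ 2 b<n) ⟩
  2 * n ∸ 1      ≤⟨ 2n∸1≤m ⟩
  m              ∎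
  where open ≤-Reasoning

pronics-incongruent : ∀ n m .{{_ : NonZero m}} → 2 * n ∸ 1 ≤ m → (Prime m ⊎ IsPowerOfTwo m) →
  ∀ k l → 1 ≤ k → k < l → l ≤ n → ¬ (k * (k ∸ 1) ≡ₘ l * (l ∸ 1) [mod m ])
pronics-incongruent n m 2n∸1≤m m-special (suc a) (suc b) (s≤s z≤n) (s≤s a<b) b<n Pa≡Pb =
  small-product-nonmultiple m-special 0<d d<m (s≤s z≤n) s<m d+s-odd m∣ds
  where
  open ≤-Reasoning
  a≤b = <⇒≤ a<b
  d = b ∸ a
  s = suc (a + b)
  2b<m : 2 * b < m
  2b<m = double-below b<n 2n∸1≤m
  0<d : 0 < d
  0<d = m<n⇒0<n∸m a<b
  d<m : d < m
  d<m = begin-strict d ≤⟨ m∸n≤m b a ⟩ b ≤⟨ m≤m*n b 2 ⟩ b * 2 ≡⟨ *-comm b 2 ⟩ 2 * b <⟨ 2b<m ⟩ m ∎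
  s<m : s < m
  s<m = begin-strict
    s       ≤⟨ +-monoˡ-< b a<b ⟩
    b + b   ≡⟨ cong (b +_) (sym (+-identityʳ b)) ⟩
    2 * b   <⟨ 2b<m ⟩
    m       ∎
  d+s-odd : ¬ 2 ∣ d + s
  d+s-odd = subst (λ t → ¬ 2 ∣ t) (sym (gap-plus-sum a≤b)) (odd-not-even b)
  m∣ds : m ∣ d * s
  m∣ds = ≡ₘ-shift⇒∣ (suc a * a) (d * s) m (trans Pa≡Pb (%-congˡ (pronic-gap a≤b)))

half-modulus-bound : ∀ h n'' → 5 * (2 * h) ≤ 12 * suc (suc n'') → h ≤ 2 * suc n''
half-modulus-bound h n'' 5m≤12n = s≤s⁻¹ (*-cancelˡ-< 10 h (suc (2 * suc n'')) (begin-strict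
  10 * h                  ≡⟨ *-assoc 5 2 h ⟩
  5 * (2 * h)             ≤⟨ 5m≤12n ⟩
  12 * n                  <⟨ subst (suc (12 * n) ≤_) (slack n'') (m≤m+n (suc (12 * n)) (5 + 8 * n'')) ⟩
  10 * suc (2 * suc n'')  ∎))
  where
  open ≤-Reasoning
  n = suc (suc n'')
  slack : ∀ x → suc (12 * suc (suc x)) + (5 + 8 * x) ≡ 10 * suc (2 * suc x)
  slack = solve-∀

doubled-pronics-collide : ∀ n m .{{_ : NonZero m}} → 1 < n → 2 * n ∸ 1 ≤ m →
  IsPowerOfTwo m → 5 * m ≤ 12 * n →
  ∃ λ k → ∃ λ l → 1 ≤ k × k < l × l ≤ n × (2 * (k * (k ∸ 1)) ≡ₘ 2 * (l * (l ∸ 1)) [mod m ])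
doubled-pronics-collide n m 1<n 2n∸1≤m (zero , refl) _ with double-below 1<n 2n∸1≤m
... | s≤s ()
doubled-pronics-collide n@(suc b@(suc n'')) m (s≤s (s≤s z≤n)) 2n∸1≤m (suc i , refl) 5m≤12n =
  suc a , n , s≤s z≤n , s≤s a<b , ≤-refl , 2Pa≡2Pb
  where
  h = 2 ^ i
  b<h : b < h
  b<h = *-cancelˡ-< 2 b h (double-below {b} ≤-refl 2n∸1≤m)
  a = h ∸ n
  n+a≡h : n + a ≡ h
  n+a≡h = m+[n∸m]≡n b<h
  a<b : a < b
  a<b = +-cancelˡ-< n a b (begin-strict
    n + a   ≡⟨ n+a≡h ⟩
    h       ≤⟨ half-modulus-bound h n'' 5m≤12n ⟩
    2 * b   ≡⟨ cong (b +_) (+-identityʳ b) ⟩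
    b + b   <⟨ n<1+n (b + b) ⟩
    n + b   ∎)
    where open ≤-Reasoning
  s≡h : suc (a + b) ≡ h
  s≡h = trans (sym (+-suc a b)) (trans (+-comm a n) n+a≡h)
  2Pa≡2Pb : 2 * (suc a * a) ≡ₘ 2 * (suc b * b) [mod m ]
  2Pa≡2Pb = sym (begin
    2 * (suc b * b) % m                             ≡⟨ %-congˡ (doubled-pronic-gap (<⇒≤ a<b)) ⟩
    (2 * (suc a * a) + (b ∸ a) * (2 * suc (a + b))) % m
                                 ≡⟨ cong (λ t → (2 * (suc a * a) + (b ∸ a) * (2 * t)) % m) s≡h ⟩
    (2 * (suc a * a) + (b ∸ a) * m) % m             ≡⟨ [m+kn]%n≡m%n (2 * (suc a * a)) (b ∸ a) m ⟩
    2 * (suc a * a) % m                             ∎)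
    where open ≡-Reasoning

theorem2p2 : (n m : ℕ) → .{{_ : NonZero m}} → 1 < n → 2 * n ∸ 1 ≤ m →
    (((Prime m ⊎ IsPowerOfTwo m) →
        ∀ k l → 1 ≤ k → k < l → l ≤ n → ¬ (k * (k ∸ 1) ≡ₘ l * (l ∸ 1) [mod m ]))
    × ((IsPowerOfTwo m → 5 * m ≤ 12 * n →
        ∃ λ k → ∃ λ l → 1 ≤ k × k < l × l ≤ n × (2 * (k * (k ∸ 1)) ≡ₘ 2 * (l * (l ∸ 1)) [mod m ]))))
theorem2p2 n m 1<n 2n∸1≤m =
  pronics-incongruent n m 2n∸1≤m , doubled-pronics-collide n m 1<n 2n∸1≤m
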